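{- Let $q$ be a prime power and let $X_q(3,1)$ be the graph whose vertices are the lines of $\operatorname{AG}(3,q)$, two distinct lines being adjacent iff they intersect. Let $U$ be an induced subgraph of $X_q(3,1)$ isomorphic to the complete bipartite graph $K_{q,q}$, with parts $\{\ell_{1,1},\dots,\ell_{1,q}\}$ and $\{\ell_{2,1},\dots,\ell_{2,q}\}$ (so lines in the same part are pairwise non-intersecting and lines in different parts intersect). Then for each $i\in\{1,2\}$, the lines $\ell_{i,1},\dots,\ell_{i,q}$ are either pairwise parallel, forming a parallel class of lines of some affine plane $\operatorname{AG}(2,q)$ contained in $\operatorname{AG}(3,q)$, or pairwise skew.
   Context: $\operatorname{AG}(3,q)$ is the affine space whose points, lines and planes are cosets of subspaces of dimension $0,1,2$ of $\mathbb{F}_q^3$. Two lines are parallel if they are cosets of the same 1-dimensional subspace, and skew if they are disjoint and not parallel. -}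

module Defs where

open import Level using (Level; _⊔_)
open import Algebra.Bundles using (CommutativeRing)
open import Data.Nat using (ℕ)
open import Data.Fin using (Fin)
open import Data.Product using (Σ; ∃; _×_; _,_)
open import Data.Sum using (_⊎_)
open import Relation.Nullary using (¬_)
open import Relation.Binary.PropositionalEquality using (_≡_)

record IsField {c ℓ : Level} (F : CommutativeRing c ℓ) : Set (c ⊔ ℓ) where
  open CommutativeRing F
  field
    0≉1 : ¬ (0# ≈ 1#)
    inverse : ∀ x → ¬ (x ≈ 0#) → ∃ λ y → (x * y) ≈ 1#

HasSize : {c ℓ : Level} (F : CommutativeRing c ℓ) → ℕ → Set (c ⊔ ℓ)
HasSize F q = Σ (Fin q → Carrier) λ e →
    (∀ i j → e i ≈ e j → i ≡ j) × (∀ x → ∃ λ i → e i ≈ x)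
  where open CommutativeRing F

module AG3 {c ℓ : Level} (F : CommutativeRing c ℓ) where
  open CommutativeRing F

  record Pt : Set c where
    constructor pt
    field
      x₁ x₂ x₃ : Carrier
  open Pt

  _≈ₚ_ : Pt → Pt → Set ℓ
  P ≈ₚ Q = (x₁ P ≈ x₁ Q) × (x₂ P ≈ x₂ Q) × (x₃ P ≈ x₃ Q)

  _⊕_ : Pt → Pt → Pt
  P ⊕ Q = pt (x₁ P + x₁ Q) (x₂ P + x₂ Q) (x₃ P + x₃ Q)

  _·_ : Carrier → Pt → Pt
  a · P = pt (a * x₁ P) (a * x₂ P) (a * x₃ P)

  𝟎 : Pt
  𝟎 = pt 0# 0# 0#

  record Line : Set (c ⊔ ℓ) where
    constructor line
    field
      base : Pt
      dir  : Pt
      dir≉0 : ¬ (dir ≈ₚ 𝟎)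
  open Line

  _∈ₗ_ : Pt → Line → Set (c ⊔ ℓ)
  P ∈ₗ L = ∃ λ t → P ≈ₚ (base L ⊕ (t · dir L))

  SameLine : Line → Line → Set (c ⊔ ℓ)
  SameLine L M = ∀ P → (P ∈ₗ L → P ∈ₗ M) × (P ∈ₗ M → P ∈ₗ L)

  Intersect : Line → Line → Set (c ⊔ ℓ)
  Intersect L M = ∃ λ P → (P ∈ₗ L) × (P ∈ₗ M)

  Parallel : Line → Line → Set (c ⊔ ℓ)
  Parallel L M = ∃ λ a → dir L ≈ₚ (a · dir M)

  Skew : Line → Line → Set (c ⊔ ℓ)
  Skew L M = ¬ Intersect L M × ¬ Parallel L M

  record Plane : Set (c ⊔ ℓ) where
    constructor plane
    field
      pbase : Pt
      u v : Pt
      indep : ∀ a b → ((a · u) ⊕ (b · v)) ≈ₚ 𝟎 → (a ≈ 0#) × (b ≈ 0#)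
  open Plane

  _∈ₚ_ : Pt → Plane → Set (c ⊔ ℓ)
  P ∈ₚ π = ∃ λ a → ∃ λ b → P ≈ₚ (pbase π ⊕ ((a · u π) ⊕ (b · v π)))

  _⊆_ : Line → Plane → Set (c ⊔ ℓ)
  L ⊆ π = ∀ P → P ∈ₗ L → P ∈ₚ π

  ParallelClassOf : {q : ℕ} → Plane → (Fin q → Line) → Set (c ⊔ ℓ)
  ParallelClassOf {q} π ℓ =
      (∀ j → ℓ j ⊆ π)
    × (∀ j k → Parallel (ℓ j) (ℓ k))
    × (∀ (m : Line) → m ⊆ π → (∀ j → Parallel m (ℓ j)) → ∃ λ j → SameLine m (ℓ j))

module Submission where

-- Suppose two lines A j, A k of one part are parallel. Being disjoint, they span a plane π. Every
-- line of the other part meets both, in two distinct points, so lies in π; then every A l meets two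
-- disjoint lines B of π, so lies in π too. Disjoint coplanar lines are parallel, so the A l are q
-- pairwise parallel disjoint lines of π, and since the lines of π in that direction are indexed by
-- the q values of a coordinate, they exhaust the parallel class. Hence either some pair, and then
-- every pair, is parallel, or no pair is, and the lines of the part are pairwise skew.

open import Defs
open import Level using (Level)
open import Algebra.Bundles using (CommutativeRing; RawRing)
open import Algebra.Solver.Ring.AlmostCommutativeRing
  using (fromCommutativeRing; _-Raw-AlmostCommutative⟶_)
open import Data.Empty using (⊥-elim)
open import Data.Fin as Fin using (Fin)
open import Data.Fin.Properties using (any?; punchOut-injective; injective⇒≤)
open import Data.Integer as ℤ using (ℤ; +_; -[1+_])
import Data.Integer.Properties as ℤ
open import Data.Maybe using (Maybe; just; nothing)
open import Data.Nat as ℕ using (ℕ; zero; suc)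
import Data.Nat.Properties as ℕ
open import Data.Product using (∃; _×_; _,_; proj₁; proj₂)
open import Data.Sum using (_⊎_; inj₁; inj₂)
open import Function.Base using (_∘_)
open import Function.Definitions using (Injective)
open import Relation.Binary.Definitions using (Decidable)
open import Relation.Binary.PropositionalEquality as ≡ using (_≡_; _≢_)
open import Relation.Nullary using (¬_; Dec; yes; no)
open import Relation.Nullary.Decidable using (map′; _×-dec_)
open import Relation.Nullary.Negation using (contradiction)

-- The ring solver needs a coefficient ring in which constants compute, so it is run with integer
-- coefficients through the canonical map ℤ → R.
module IntegerCoefficientSolver {c ℓ : Level} (R : CommutativeRing c ℓ) where
  open CommutativeRing R
  open import Algebra.Properties.Ring ring using (-‿distribˡ-*; -‿distribʳ-*; -‿involutive; -0#≈0#)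
  open import Algebra.Properties.AbelianGroup +-abelianGroup using (⁻¹-∙-comm)
  open import Algebra.Properties.Semiring.Mult.TCOptimised semiring
    using (×-homo-+; ×1-homo-*; 1+×) renaming (_×_ to _×ℕ_)
  open import Relation.Binary.Reasoning.Setoid setoid

  ⟦_⟧ℕ : ℕ → Carrier
  ⟦ n ⟧ℕ = n ×ℕ 1#

  ⟦_⟧ℤ : ℤ → Carrier
  ⟦ + n ⟧ℤ      = ⟦ n ⟧ℕ
  ⟦ -[1+ n ] ⟧ℤ = - ⟦ suc n ⟧ℕ

  -‿homo : ∀ i → ⟦ ℤ.- i ⟧ℤ ≈ - ⟦ i ⟧ℤ
  -‿homo (+ zero)  = sym -0#≈0#
  -‿homo (+ suc n) = refl
  -‿homo -[1+ n ]  = sym (-‿involutive _)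

  [1+a]-[1+b]≈a-b : ∀ a b → (1# + a) - (1# + b) ≈ a - b
  [1+a]-[1+b]≈a-b a b = begin
    (1# + a) - (1# + b)    ≈⟨ +-congˡ (⁻¹-∙-comm 1# b) ⟨
    (1# + a) + (- 1# - b)  ≈⟨ +-congʳ (+-comm 1# a) ⟩
    (a + 1#) + (- 1# - b)  ≈⟨ +-assoc a 1# _ ⟩
    a + (1# + (- 1# - b))  ≈⟨ +-congˡ (+-assoc 1# (- 1#) (- b)) ⟨
    a + ((1# - 1#) - b)    ≈⟨ +-congˡ (+-congʳ (-‿inverseʳ 1#)) ⟩
    a + (0# - b)           ≈⟨ +-congˡ (+-identityˡ (- b)) ⟩
    a - b                  ∎

  ⊖-homo : ∀ m n → ⟦ m ℤ.⊖ n ⟧ℤ ≈ ⟦ m ⟧ℕ - ⟦ n ⟧ℕ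
  ⊖-homo zero    zero    = sym (-‿inverseʳ 0#)
  ⊖-homo (suc m) zero    = trans (sym (+-identityʳ _)) (+-congˡ (sym -0#≈0#))
  ⊖-homo zero    (suc n) = sym (+-identityˡ _)
  ⊖-homo (suc m) (suc n) = begin
    ⟦ suc m ℤ.⊖ suc n ⟧ℤ       ≡⟨ ≡.cong ⟦_⟧ℤ (ℤ.[1+m]⊖[1+n]≡m⊖n m n) ⟩
    ⟦ m ℤ.⊖ n ⟧ℤ               ≈⟨ ⊖-homo m n ⟩
    ⟦ m ⟧ℕ - ⟦ n ⟧ℕ            ≈⟨ [1+a]-[1+b]≈a-b _ _ ⟨
    (1# + ⟦ m ⟧ℕ) - (1# + ⟦ n ⟧ℕ) ≈⟨ +-cong (1+× m 1#) (-‿cong (1+× n 1#)) ⟨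
    ⟦ suc m ⟧ℕ - ⟦ suc n ⟧ℕ    ∎

  +-homo : ∀ i j → ⟦ i ℤ.+ j ⟧ℤ ≈ ⟦ i ⟧ℤ + ⟦ j ⟧ℤ
  +-homo (+ m)    (+ n)    = ×-homo-+ 1# m n
  +-homo (+ m)    -[1+ n ] = ⊖-homo m (suc n)
  +-homo -[1+ m ] (+ n)    = trans (⊖-homo n (suc m)) (+-comm _ _)
  +-homo -[1+ m ] -[1+ n ] = begin
    - ⟦ suc (suc (m ℕ.+ n)) ⟧ℕ      ≡⟨ ≡.cong (λ k → - ⟦ k ⟧ℕ) (ℕ.+-suc (suc m) n) ⟨
    - ⟦ suc m ℕ.+ suc n ⟧ℕ          ≈⟨ -‿cong (×-homo-+ 1# (suc m) (suc n)) ⟩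
    - (⟦ suc m ⟧ℕ + ⟦ suc n ⟧ℕ)     ≈⟨ ⁻¹-∙-comm _ _ ⟨
    - ⟦ suc m ⟧ℕ - ⟦ suc n ⟧ℕ       ∎

  +*-homo : ∀ m n → ⟦ + m ℤ.* + n ⟧ℤ ≈ ⟦ m ⟧ℕ * ⟦ n ⟧ℕ
  +*-homo m n = begin
    ⟦ + m ℤ.* + n ⟧ℤ  ≡⟨ ≡.cong ⟦_⟧ℤ (ℤ.pos-* m n) ⟨
    ⟦ m ℕ.* n ⟧ℕ      ≈⟨ ×1-homo-* m n ⟩
    ⟦ m ⟧ℕ * ⟦ n ⟧ℕ   ∎

  *-homo : ∀ i j → ⟦ i ℤ.* j ⟧ℤ ≈ ⟦ i ⟧ℤ * ⟦ j ⟧ℤ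
  *-homo (+ m) (+ n) = +*-homo m n
  *-homo (+ m) -[1+ n ] = begin
    ⟦ + m ℤ.* ℤ.- (+ suc n) ⟧ℤ  ≡⟨ ≡.cong ⟦_⟧ℤ (ℤ.neg-distribʳ-* (+ m) (+ suc n)) ⟨
    ⟦ ℤ.- (+ m ℤ.* + suc n) ⟧ℤ  ≈⟨ -‿homo (+ m ℤ.* + suc n) ⟩
    - ⟦ + m ℤ.* + suc n ⟧ℤ      ≈⟨ -‿cong (+*-homo m (suc n)) ⟩
    - (⟦ m ⟧ℕ * ⟦ suc n ⟧ℕ)     ≈⟨ -‿distribʳ-* _ _ ⟩
    ⟦ m ⟧ℕ * - ⟦ suc n ⟧ℕ       ∎
  *-homo -[1+ m ] (+ n) = begin
    ⟦ ℤ.- (+ suc m) ℤ.* + n ⟧ℤ  ≡⟨ ≡.cong ⟦_⟧ℤ (ℤ.neg-distribˡ-* (+ suc m) (+ n)) ⟨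
    ⟦ ℤ.- (+ suc m ℤ.* + n) ⟧ℤ  ≈⟨ -‿homo (+ suc m ℤ.* + n) ⟩
    - ⟦ + suc m ℤ.* + n ⟧ℤ      ≈⟨ -‿cong (+*-homo (suc m) n) ⟩
    - (⟦ suc m ⟧ℕ * ⟦ n ⟧ℕ)     ≈⟨ -‿distribˡ-* _ _ ⟩
    - ⟦ suc m ⟧ℕ * ⟦ n ⟧ℕ       ∎
  *-homo -[1+ m ] -[1+ n ] = begin
    ⟦ + suc m ℤ.* + suc n ⟧ℤ       ≈⟨ +*-homo (suc m) (suc n) ⟩
    ⟦ suc m ⟧ℕ * ⟦ suc n ⟧ℕ        ≈⟨ -‿involutive _ ⟨
    - - (⟦ suc m ⟧ℕ * ⟦ suc n ⟧ℕ)  ≈⟨ -‿cong (-‿distribˡ-* _ _) ⟩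
    - (- ⟦ suc m ⟧ℕ * ⟦ suc n ⟧ℕ)  ≈⟨ -‿distribʳ-* _ _ ⟩
    - ⟦ suc m ⟧ℕ * - ⟦ suc n ⟧ℕ    ∎

  ℤ-rawRing : RawRing _ _
  ℤ-rawRing = record
    { Carrier = ℤ ; _≈_ = _≡_ ; _+_ = ℤ._+_ ; _*_ = ℤ._*_ ; -_ = ℤ.-_ ; 0# = + 0 ; 1# = + 1 }

  ℤ⟶R : ℤ-rawRing -Raw-AlmostCommutative⟶ fromCommutativeRing R
  ℤ⟶R = record
    { ⟦_⟧ = ⟦_⟧ℤ ; +-homo = +-homo ; *-homo = *-homo ; -‿homo = -‿homo
    ; 0-homo = refl ; 1-homo = refl }

  coefficient≟ : ∀ i j → Maybe (⟦ i ⟧ℤ ≈ ⟦ j ⟧ℤ)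
  coefficient≟ i j with i ℤ.≟ j
  ... | yes ≡.refl = just refl
  ... | no _       = nothing

  open import Algebra.Solver.Ring ℤ-rawRing (fromCommutativeRing R) ℤ⟶R coefficient≟ public

injective⇒surjective : ∀ {n} {f : Fin n → Fin n} → Injective _≡_ _≡_ f → ∀ k → ∃ λ l → f l ≡ k
injective⇒surjective {zero}  _ ()
injective⇒surjective {suc n} {f} f-injective k with any? (λ l → f l Fin.≟ k)
... | yes hit = hit
... | no miss = contradiction (injective⇒≤ punchOut∘f-injective) ℕ.1+n≰n
  where
  avoids : ∀ l → k ≢ f l
  avoids l k≡fl = miss (l , ≡.sym k≡fl)
  punchOut∘f-injective : Injective _≡_ _≡_ (λ l → Fin.punchOut (avoids l))
  punchOut∘f-injective eq = f-injective (punchOut-injective (avoids _) (avoids _) eq)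

module Finite {c ℓ : Level} {F : CommutativeRing c ℓ} {q : ℕ} (size : HasSize F q) where
  open CommutativeRing F

  element : Fin q → Carrier
  element = size .proj₁

  index : Carrier → Fin q
  index x = size .proj₂ .proj₂ x .proj₁

  element-index : ∀ x → element (index x) ≈ x
  element-index x = size .proj₂ .proj₂ x .proj₂

  index-injective : ∀ {x y} → index x ≡ index y → x ≈ y
  index-injective {x} {y} eq =
    trans (sym (element-index x)) (trans (reflexive (≡.cong element eq)) (element-index y))

  index-cong : ∀ {x y} → x ≈ y → index x ≡ index y
  index-cong {x} {y} x≈y =
    size .proj₂ .proj₁ _ _ (trans (element-index x) (trans x≈y (sym (element-index y))))

  _≟_ : Decidable _≈_
  x ≟ y = map′ index-injective index-cong (index x Fin.≟ index y)

  ∃? : {p : Level} {P : Carrier → Set p} → (∀ {x y} → x ≈ y → P x → P y) → (∀ x → Dec (P x)) → Dec (∃ P)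
  ∃? {P = P} resp P? with any? (λ i → P? (element i))
  ... | yes (i , Pi) = yes (element i , Pi)
  ... | no ∄       = no λ (x , Px) → ∄ (index x , resp (sym (element-index x)) Px)

  injective⇒covers : (f : Fin q → Carrier) → (∀ {i j} → f i ≈ f j → i ≡ j) → ∀ x → ∃ λ i → f i ≈ x
  injective⇒covers f f-injective x =
    let i , eq = injective⇒surjective {f = index ∘ f} (f-injective ∘ index-injective) (index x)
    in i , index-injective eq

  index-≉ : ∀ {x y} → ¬ x ≈ y → index x ≢ index y
  index-≉ x≉y eq = x≉y (index-injective eq)

module DiscreteFieldGeometry {c ℓ : Level} (F : CommutativeRing c ℓ) (isField : IsField F)
         (_≟_ : Decidable (CommutativeRing._≈_ F)) where
  open CommutativeRing F
  open IsField isField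
  open AG3 F
  open Pt
  open Line
  open Plane
  open IntegerCoefficientSolver F using (solve; _:=_; _:+_; _:-_; _:*_; :-_; con; Polynomial)
  open import Algebra.Properties.Group +-group using (x∙y⁻¹≈ε⇒x≈y; x≈y⇒x∙y⁻¹≈ε)

  one : ∀ {n} → Polynomial n
  one = con (+ 1)

  Δ : ∀ {a b} → a ≈ b → a - b ≈ 0#
  Δ = x≈y⇒x∙y⁻¹≈ε

  infixl 6 _+⁰_ _-⁰_
  infixl 7 _*⁰_

  _+⁰_ : ∀ {a b} → a ≈ 0# → b ≈ 0# → a + b ≈ 0#
  ha +⁰ hb = trans (+-cong ha hb) (+-identityʳ 0#)

  _-⁰_ : ∀ {a b} → a ≈ 0# → b ≈ 0# → a - b ≈ 0#
  ha -⁰ hb = trans (+-cong ha (-‿cong hb)) (-‿inverseʳ 0#)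

  _*⁰_ : ∀ k {a} → a ≈ 0# → k * a ≈ 0#
  k *⁰ ha = trans (*-congˡ ha) (zeroʳ k)

  -- A linear-combination certificate: `L - R` is, as a ring identity, a combination
  -- of the differences `Lᵢ - Rᵢ` of hypotheses `Lᵢ ≈ Rᵢ`.
  by-combination : ∀ {L R d} → L - R ≈ d → d ≈ 0# → L ≈ R
  by-combination e h = x∙y⁻¹≈ε⇒x≈y _ _ (trans e h)

  _⊖_ : Pt → Pt → Pt
  P ⊖ Q = pt (x₁ P - x₁ Q) (x₂ P - x₂ Q) (x₃ P - x₃ Q)

  -- The solver certificates are large terms; unless they are abstract, later conversion checks
  -- unfold them and exhaust memory.
  abstract
    x≉0∧xy≈0⇒y≈0 : ∀ {x y} → ¬ x ≈ 0# → x * y ≈ 0# → y ≈ 0#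
    x≉0∧xy≈0⇒y≈0 {x} {y} x≉0 xy≈0 with inverse x x≉0
    ... | x⁻¹ , xx⁻¹≈1 = trans
      (solve 3 (λ x y x⁻¹ → y := x⁻¹ :* (x :* y) :- y :* (x :* x⁻¹ :- one)) refl x y x⁻¹)
      (x⁻¹ *⁰ xy≈0 -⁰ y *⁰ Δ xx⁻¹≈1)

    ≈ₚ-trans : ∀ {P Q R} → P ≈ₚ Q → Q ≈ₚ R → P ≈ₚ R
    ≈ₚ-trans (e₁ , e₂ , e₃) (f₁ , f₂ , f₃) = trans e₁ f₁ , trans e₂ f₂ , trans e₃ f₃

    ·≈𝟎⇒≈0 : ∀ {α d} → ¬ d ≈ₚ 𝟎 → (α · d) ≈ₚ 𝟎 → α ≈ 0#
    ·≈𝟎⇒≈0 {α} d≉𝟎 (h₁ , h₂ , h₃) with α ≟ 0#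
    ... | yes α≈0 = α≈0
    ... | no α≉0  = ⊥-elim (d≉𝟎 (x≉0∧xy≈0⇒y≈0 α≉0 h₁ , x≉0∧xy≈0⇒y≈0 α≉0 h₂ , x≉0∧xy≈0⇒y≈0 α≉0 h₃))

    base∈ₗ : ∀ L → base L ∈ₗ L
    base∈ₗ L = 0# , +0* _ , +0* _ , +0* _
      where
      +0* : ∀ {b} d → b ≈ b + 0# * d
      +0* {b} d = sym (trans (+-congˡ (zeroˡ d)) (+-identityʳ b))

    ∈ₗ-resp-≈ₚ : ∀ {P Q L} → P ≈ₚ Q → Q ∈ₗ L → P ∈ₗ L
    ∈ₗ-resp-≈ₚ P≈Q (t , h) = t , ≈ₚ-trans P≈Q h

    Parallel-refl : ∀ L → Parallel L L
    Parallel-refl L = 1# , sym (*-identityˡ _) , sym (*-identityˡ _) , sym (*-identityˡ _)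

    parallel-factor≉0 : ∀ {a} L M → dir L ≈ₚ (a · dir M) → ¬ a ≈ 0#
    parallel-factor≉0 {a} L M (h₁ , h₂ , h₃) a≈0 = dir≉0 L (vanish h₁ , vanish h₂ , vanish h₃)
      where
      vanish : ∀ {x y} → x ≈ a * y → x ≈ 0#
      vanish {y = y} h = trans h (trans (*-congʳ a≈0) (zeroˡ y))

    Parallel-sym : ∀ {L M} → Parallel L M → Parallel M L
    Parallel-sym {L} {M} (a , h₁ , h₂ , h₃) with inverse a (parallel-factor≉0 L M (h₁ , h₂ , h₃))
    ... | a⁻¹ , aa⁻¹≈1 = a⁻¹ , divide h₁ , divide h₂ , divide h₃
      where
      divide : ∀ {x y} → x ≈ a * y → y ≈ a⁻¹ * x
      divide {x} {y} h = by-combination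
        (solve 4 (λ x y a a⁻¹ → y :- a⁻¹ :* x := :- y :* (a :* a⁻¹ :- one) :- a⁻¹ :* (x :- a :* y)) refl x y a a⁻¹)
        ((- y) *⁰ Δ aa⁻¹≈1 -⁰ a⁻¹ *⁰ Δ h)

    parallel-through⇒SameLine : ∀ {M N} → Parallel M N → base M ∈ₗ N → SameLine M N
    parallel-through⇒SameLine {M} {N} (a , h₁ , h₂ , h₃) (s , k₁ , k₂ , k₃) P
      with inverse a (parallel-factor≉0 M N (h₁ , h₂ , h₃))
    ... | a⁻¹ , aa⁻¹≈1 =
          (λ { (t , p₁ , p₂ , p₃) → s + t * a , onN p₁ k₁ h₁ , onN p₂ k₂ h₂ , onN p₃ k₃ h₃ })
        , (λ { (t , p₁ , p₂ , p₃) → (t - s) * a⁻¹ , onM p₁ k₁ h₁ , onM p₂ k₂ h₂ , onM p₃ k₃ h₃ })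
      where
      onN : ∀ {P t bM dM bN dN} → P ≈ bM + t * dM → bM ≈ bN + s * dN → dM ≈ a * dN →
            P ≈ bN + (s + t * a) * dN
      onN {P} {t} {bM} {dM} {bN} {dN} p k h = by-combination
        (solve 8 (λ P t bM dM bN dN s a → P :- (bN :+ (s :+ t :* a) :* dN) :=
                    (P :- (bM :+ t :* dM)) :+ (bM :- (bN :+ s :* dN)) :+ t :* (dM :- a :* dN))
               refl P t bM dM bN dN s a)
        (Δ p +⁰ Δ k +⁰ t *⁰ Δ h)
      onM : ∀ {P t bM dM bN dN} → P ≈ bN + t * dN → bM ≈ bN + s * dN → dM ≈ a * dN →
            P ≈ bM + ((t - s) * a⁻¹) * dM
      onM {P} {t} {bM} {dM} {bN} {dN} p k h = by-combination
        (solve 9 (λ P t bM dM bN dN s a a⁻¹ → P :- (bM :+ ((t :- s) :* a⁻¹) :* dM) :=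
                    (P :- (bN :+ t :* dN)) :- (bM :- (bN :+ s :* dN)) :- ((t :- s) :* a⁻¹) :* (dM :- a :* dN)
                    :- ((t :- s) :* dN) :* (a :* a⁻¹ :- one))
               refl P t bM dM bN dN s a a⁻¹)
        (Δ p -⁰ Δ k -⁰ ((t - s) * a⁻¹) *⁰ Δ h -⁰ ((t - s) * dN) *⁰ Δ aa⁻¹≈1)

  spanPlane : (A A′ : Line) → ¬ Intersect A A′ → Plane
  spanPlane A A′ A∩A′≡∅ = plane (base A) (dir A) (base A′ ⊖ base A) independent
    where
    abstract
      independent : ∀ α β → ((α · dir A) ⊕ (β · (base A′ ⊖ base A))) ≈ₚ 𝟎 → (α ≈ 0#) × (β ≈ 0#)
      independent α β (h₁ , h₂ , h₃) with β ≟ 0#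
      ... | yes β≈0 = ·≈𝟎⇒≈0 (dir≉0 A) (drop h₁ , drop h₂ , drop h₃) , β≈0
        where
        drop : ∀ {d w} → α * d + β * w ≈ 0# → α * d ≈ 0#
        drop {d} {w} h = trans
          (solve 4 (λ α β d w → α :* d := (α :* d :+ β :* w) :- w :* β) refl α β d w)
          (h -⁰ w *⁰ β≈0)
      ... | no β≉0 with inverse β β≉0
      ... | β⁻¹ , ββ⁻¹≈1 =
        ⊥-elim (A∩A′≡∅ (base A′ , (- (α * β⁻¹) , solve-b′ h₁ , solve-b′ h₂ , solve-b′ h₃) , base∈ₗ A′))
        where
        solve-b′ : ∀ {d b′ b} → α * d + β * (b′ - b) ≈ 0# → b′ ≈ b + (- (α * β⁻¹)) * d
        solve-b′ {d} {b′} {b} h = by-combination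
          (solve 6 (λ α β β⁻¹ d b′ b → b′ :- (b :+ (:- (α :* β⁻¹)) :* d) :=
                      β⁻¹ :* (α :* d :+ β :* (b′ :- b)) :- (b′ :- b) :* (β :* β⁻¹ :- one))
                 refl α β β⁻¹ d b′ b)
          (β⁻¹ *⁰ h -⁰ (b′ - b) *⁰ Δ ββ⁻¹≈1)

  abstract
    ⊆spanPlaneˡ : ∀ A A′ A∩A′≡∅ → A ⊆ spanPlane A A′ A∩A′≡∅
    ⊆spanPlaneˡ A A′ _ P (t , h₁ , h₂ , h₃) = t , 0# , pad h₁ , pad h₂ , pad h₃
      where
      pad : ∀ {P b d w} → P ≈ b + t * d → P ≈ b + (t * d + 0# * w)
      pad {P} {b} {d} {w} h = by-combination
        (solve 5 (λ P b t d w → P :- (b :+ (t :* d :+ con (+ 0) :* w)) := P :- (b :+ t :* d)) refl P b t d w)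
        (Δ h)

    ⊆spanPlaneʳ : ∀ A A′ A∩A′≡∅ → Parallel A′ A → A′ ⊆ spanPlane A A′ A∩A′≡∅
    ⊆spanPlaneʳ A A′ _ (a , k₁ , k₂ , k₃) P (t , h₁ , h₂ , h₃) =
      t * a , 1# , shift h₁ k₁ , shift h₂ k₂ , shift h₃ k₃
      where
      shift : ∀ {P b′ d′ d b} → P ≈ b′ + t * d′ → d′ ≈ a * d → P ≈ b + ((t * a) * d + 1# * (b′ - b))
      shift {P} {b′} {d′} {d} {b} h k = by-combination
        (solve 7 (λ P b′ t d′ a d b → P :- (b :+ ((t :* a) :* d :+ one :* (b′ :- b))) :=
                    (P :- (b′ :+ t :* d′)) :+ t :* (d′ :- a :* d))
               refl P b′ t d′ a d b)
        (Δ h +⁰ t *⁰ Δ k)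

    two-points⇒⊆ : ∀ {N π P P′} → P ∈ₗ N → P′ ∈ₗ N → P ∈ₚ π → P′ ∈ₚ π → ¬ P ≈ₚ P′ → N ⊆ π
    two-points⇒⊆ (t , h₁ , h₂ , h₃) (t′ , h′₁ , h′₂ , h′₃)
                 (a , b , k₁ , k₂ , k₃) (a′ , b′ , k′₁ , k′₂ , k′₃) P≉P′ X (s , g₁ , g₂ , g₃)
      with t ≟ t′
    ... | yes t≈t′ = ⊥-elim (P≉P′ (collide h₁ h′₁ , collide h₂ h′₂ , collide h₃ h′₃))
      where
      collide : ∀ {P P′ b d} → P ≈ b + t * d → P′ ≈ b + t′ * d → P ≈ P′
      collide {P} {P′} {b} {d} h h′ = by-combination
        (solve 6 (λ P P′ b d t t′ → P :- P′ := (P :- (b :+ t :* d)) :- (P′ :- (b :+ t′ :* d)) :+ d :* (t :- t′))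
               refl P P′ b d t t′)
        (Δ h -⁰ Δ h′ +⁰ d *⁰ Δ t≈t′)
    ... | no t≉t′ with inverse (t′ - t) (λ t′-t≈0 → t≉t′ (sym (x∙y⁻¹≈ε⇒x≈y t′ t t′-t≈0)))
    ... | κ , [t′-t]κ≈1 =
        a + λ′ * (a′ - a) , b + λ′ * (b′ - b) ,
        interpolate g₁ h₁ h′₁ k₁ k′₁ , interpolate g₂ h₂ h′₂ k₂ k′₂ , interpolate g₃ h₃ h′₃ k₃ k′₃
      where
      -- X = P + λ′ (P′ − P), with λ′ the ratio of the line parameters
      λ′ : Carrier
      λ′ = (s - t) * κ
      interpolate : ∀ {X bN dN P P′ p u v} →
        X ≈ bN + s * dN → P ≈ bN + t * dN → P′ ≈ bN + t′ * dN →
        P ≈ p + (a * u + b * v) → P′ ≈ p + (a′ * u + b′ * v) →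
        X ≈ p + ((a + λ′ * (a′ - a)) * u + (b + λ′ * (b′ - b)) * v)
      interpolate {X} {bN} {dN} {P} {P′} {p} {u} {v} g h h′ k k′ = by-combination
        (solve 16 (λ X bN s dN P t P′ t′ p a u b v a′ b′ κ →
            X :- (p :+ ((a :+ ((s :- t) :* κ) :* (a′ :- a)) :* u :+ (b :+ ((s :- t) :* κ) :* (b′ :- b)) :* v)) :=
            (X :- (bN :+ s :* dN)) :- (P :- (bN :+ t :* dN)) :+ (P :- (p :+ (a :* u :+ b :* v)))
            :- ((s :- t) :* dN) :* ((t′ :- t) :* κ :- one)
            :+ ((s :- t) :* κ) :* ((P :- (bN :+ t :* dN)) :- (P′ :- (bN :+ t′ :* dN))
                                  :+ (P′ :- (p :+ (a′ :* u :+ b′ :* v))) :- (P :- (p :+ (a :* u :+ b :* v)))))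
          refl X bN s dN P t P′ t′ p a u b v a′ b′ κ)
        (Δ g -⁰ Δ h +⁰ Δ k -⁰ ((s - t) * dN) *⁰ Δ [t′-t]κ≈1 +⁰ λ′ *⁰ (Δ h -⁰ Δ h′ +⁰ Δ k′ -⁰ Δ k))

    ⊆⇒dir∈span : ∀ {M π} → M ⊆ π → ∃ λ α → ∃ λ β → dir M ≈ₚ ((α · u π) ⊕ (β · v π))
    ⊆⇒dir∈span {M} {π} M⊆π
      with M⊆π (base M) (base∈ₗ M) | M⊆π (base M ⊕ (1# · dir M)) (1# , refl , refl , refl)
    ... | γ , δ , h₁ , h₂ , h₃ | γ′ , δ′ , k₁ , k₂ , k₃ =
      γ′ - γ , δ′ - δ , difference h₁ k₁ , difference h₂ k₂ , difference h₃ k₃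
      where
      difference : ∀ {b d p u v} → b ≈ p + (γ * u + δ * v) → b + 1# * d ≈ p + (γ′ * u + δ′ * v) →
                   d ≈ (γ′ - γ) * u + (δ′ - δ) * v
      difference {b} {d} {p} {u} {v} h k = by-combination
        (solve 9 (λ b d p u v γ δ γ′ δ′ → d :- ((γ′ :- γ) :* u :+ (δ′ :- δ) :* v) :=
                    (b :+ one :* d :- (p :+ (γ′ :* u :+ δ′ :* v))) :- (b :- (p :+ (γ :* u :+ δ :* v))))
               refl b d p u v γ δ γ′ δ′)
        (Δ k -⁰ Δ h)

    module _ {π : Plane} {M₁ M₂ : Line} {α₁ β₁ α₂ β₂ : Carrier} where

      det≈0⇒Parallel : dir M₁ ≈ₚ ((α₁ · u π) ⊕ (β₁ · v π)) → dir M₂ ≈ₚ ((α₂ · u π) ⊕ (β₂ · v π)) →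
                       α₁ * β₂ - α₂ * β₁ ≈ 0# → Parallel M₁ M₂
      det≈0⇒Parallel (h₁ , h₂ , h₃) (k₁ , k₂ , k₃) det≈0 with α₂ ≟ 0# | β₂ ≟ 0#
      ... | no α₂≉0 | _ = α₁ * α₂⁻¹ , ratio h₁ k₁ , ratio h₂ k₂ , ratio h₃ k₃
        where
        α₂⁻¹ : Carrier
        α₂⁻¹ = inverse α₂ α₂≉0 .proj₁
        ratio : ∀ {d₁ d₂ u v} → d₁ ≈ α₁ * u + β₁ * v → d₂ ≈ α₂ * u + β₂ * v → d₁ ≈ (α₁ * α₂⁻¹) * d₂
        ratio {d₁} {d₂} {u} {v} h k = by-combination
          (solve 9 (λ d₁ d₂ u v α₁ β₁ α₂ β₂ α₂⁻¹ → d₁ :- (α₁ :* α₂⁻¹) :* d₂ :=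
               (d₁ :- (α₁ :* u :+ β₁ :* v)) :- (α₁ :* α₂⁻¹) :* (d₂ :- (α₂ :* u :+ β₂ :* v))
               :- (α₁ :* u :+ β₁ :* v) :* (α₂ :* α₂⁻¹ :- one) :- (v :* α₂⁻¹) :* (α₁ :* β₂ :- α₂ :* β₁))
             refl d₁ d₂ u v α₁ β₁ α₂ β₂ α₂⁻¹)
          (Δ h -⁰ (α₁ * α₂⁻¹) *⁰ Δ k -⁰ (α₁ * u + β₁ * v) *⁰ Δ (inverse α₂ α₂≉0 .proj₂) -⁰ (v * α₂⁻¹) *⁰ det≈0)
      ... | yes _ | no β₂≉0 = β₁ * β₂⁻¹ , ratio h₁ k₁ , ratio h₂ k₂ , ratio h₃ k₃
        where
        β₂⁻¹ : Carrier
        β₂⁻¹ = inverse β₂ β₂≉0 .proj₁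
        ratio : ∀ {d₁ d₂ u v} → d₁ ≈ α₁ * u + β₁ * v → d₂ ≈ α₂ * u + β₂ * v → d₁ ≈ (β₁ * β₂⁻¹) * d₂
        ratio {d₁} {d₂} {u} {v} h k = by-combination
          (solve 9 (λ d₁ d₂ u v α₁ β₁ α₂ β₂ β₂⁻¹ → d₁ :- (β₁ :* β₂⁻¹) :* d₂ :=
               (d₁ :- (α₁ :* u :+ β₁ :* v)) :- (β₁ :* β₂⁻¹) :* (d₂ :- (α₂ :* u :+ β₂ :* v))
               :- (α₁ :* u :+ β₁ :* v) :* (β₂ :* β₂⁻¹ :- one) :+ (u :* β₂⁻¹) :* (α₁ :* β₂ :- α₂ :* β₁))
             refl d₁ d₂ u v α₁ β₁ α₂ β₂ β₂⁻¹)
          (Δ h -⁰ (β₁ * β₂⁻¹) *⁰ Δ k -⁰ (α₁ * u + β₁ * v) *⁰ Δ (inverse β₂ β₂≉0 .proj₂) +⁰ (u * β₂⁻¹) *⁰ det≈0)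
      ... | yes α₂≈0 | yes β₂≈0 = ⊥-elim (dir≉0 M₂ (vanish k₁ , vanish k₂ , vanish k₃))
        where
        vanish : ∀ {d u v} → d ≈ α₂ * u + β₂ * v → d ≈ 0#
        vanish {d} {u} {v} k = trans
          (solve 5 (λ d u v α₂ β₂ → d := (d :- (α₂ :* u :+ β₂ :* v)) :+ u :* α₂ :+ v :* β₂) refl d u v α₂ β₂)
          (Δ k +⁰ u *⁰ α₂≈0 +⁰ v *⁰ β₂≈0)

      det≉0⇒Intersect : ∀ {γ₁ δ₁ γ₂ δ₂} →
        dir M₁ ≈ₚ ((α₁ · u π) ⊕ (β₁ · v π)) → dir M₂ ≈ₚ ((α₂ · u π) ⊕ (β₂ · v π)) →
        base M₁ ≈ₚ (pbase π ⊕ ((γ₁ · u π) ⊕ (δ₁ · v π))) → base M₂ ≈ₚ (pbase π ⊕ ((γ₂ · u π) ⊕ (δ₂ · v π))) →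
        ¬ α₁ * β₂ - α₂ * β₁ ≈ 0# → Intersect M₁ M₂
      det≉0⇒Intersect {γ₁} {δ₁} {γ₂} {δ₂} (h₁ , h₂ , h₃) (k₁ , k₂ , k₃) (f₁ , f₂ , f₃) (g₁ , g₂ , g₃) det≉0 =
        _ , (_ , refl , refl , refl) , (t₂ , meet h₁ k₁ f₁ g₁ , meet h₂ k₂ f₂ g₂ , meet h₃ k₃ f₃ g₃)
        where
        D⁻¹ : Carrier
        D⁻¹ = inverse _ det≉0 .proj₁
        -- Cramer's rule for b₁ + t₁ d₁ = b₂ + t₂ d₂ in the coordinates (u, v) of π
        t₁ t₂ : Carrier
        t₁ = ((γ₂ - γ₁) * β₂ - α₂ * (δ₂ - δ₁)) * D⁻¹
        t₂ = (β₁ * (γ₂ - γ₁) - α₁ * (δ₂ - δ₁)) * D⁻¹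
        meet : ∀ {d₁ d₂ b₁ b₂ p u v} →
               d₁ ≈ α₁ * u + β₁ * v → d₂ ≈ α₂ * u + β₂ * v →
               b₁ ≈ p + (γ₁ * u + δ₁ * v) → b₂ ≈ p + (γ₂ * u + δ₂ * v) →
               b₁ + t₁ * d₁ ≈ b₂ + t₂ * d₂
        meet {d₁} {d₂} {b₁} {b₂} {p} {u} {v} h k f g = by-combination
          (solve 16 (λ b₁ d₁ b₂ d₂ p u v α₁ β₁ α₂ β₂ γ₁ δ₁ γ₂ δ₂ D⁻¹ →
               b₁ :+ (((γ₂ :- γ₁) :* β₂ :- α₂ :* (δ₂ :- δ₁)) :* D⁻¹) :* d₁
                 :- (b₂ :+ ((β₁ :* (γ₂ :- γ₁) :- α₁ :* (δ₂ :- δ₁)) :* D⁻¹) :* d₂) :=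
               (b₁ :- (p :+ (γ₁ :* u :+ δ₁ :* v))) :- (b₂ :- (p :+ (γ₂ :* u :+ δ₂ :* v)))
               :+ (((γ₂ :- γ₁) :* β₂ :- α₂ :* (δ₂ :- δ₁)) :* D⁻¹) :* (d₁ :- (α₁ :* u :+ β₁ :* v))
               :- ((β₁ :* (γ₂ :- γ₁) :- α₁ :* (δ₂ :- δ₁)) :* D⁻¹) :* (d₂ :- (α₂ :* u :+ β₂ :* v))
               :+ (u :* (γ₂ :- γ₁) :+ v :* (δ₂ :- δ₁)) :* ((α₁ :* β₂ :- α₂ :* β₁) :* D⁻¹ :- one))
             refl b₁ d₁ b₂ d₂ p u v α₁ β₁ α₂ β₂ γ₁ δ₁ γ₂ δ₂ D⁻¹)
          (Δ f -⁰ Δ g +⁰ t₁ *⁰ Δ h -⁰ t₂ *⁰ Δ k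
           +⁰ (u * (γ₂ - γ₁) + v * (δ₂ - δ₁)) *⁰ Δ (inverse _ det≉0 .proj₂))

    same-v⇒∈ₗ : ∀ {π N X α α′ c c′ a} →
      base N ≈ₚ (pbase π ⊕ ((α · u π) ⊕ (c · v π))) → X ≈ₚ (pbase π ⊕ ((α′ · u π) ⊕ (c′ · v π))) →
      c ≈ c′ → u π ≈ₚ (a · dir N) → X ∈ₗ N
    same-v⇒∈ₗ {α = α} {α′} {c} {c′} {a} (f₁ , f₂ , f₃) (g₁ , g₂ , g₃) c≈c′ (h₁ , h₂ , h₃) =
      (α′ - α) * a , along f₁ g₁ h₁ , along f₂ g₂ h₂ , along f₃ g₃ h₃
      where
      along : ∀ {b X p u v d} → b ≈ p + (α * u + c * v) → X ≈ p + (α′ * u + c′ * v) → u ≈ a * d →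
              X ≈ b + ((α′ - α) * a) * d
      along {b} {X} {p} {u} {v} {d} f g h = by-combination
        (solve 11 (λ b X p u v d α α′ c c′ a → X :- (b :+ ((α′ :- α) :* a) :* d) :=
             (X :- (p :+ (α′ :* u :+ c′ :* v))) :- (b :- (p :+ (α :* u :+ c :* v)))
             :+ (α′ :- α) :* (u :- a :* d) :- v :* (c :- c′))
           refl b X p u v d α α′ c c′ a)
        (Δ g -⁰ Δ f +⁰ (α′ - α) *⁰ Δ h -⁰ v *⁰ Δ c≈c′)

  coplanar-disjoint⇒Parallel : ∀ {π M₁ M₂} → M₁ ⊆ π → M₂ ⊆ π → ¬ Intersect M₁ M₂ → Parallel M₁ M₂
  coplanar-disjoint⇒Parallel {π} {M₁} {M₂} M₁⊆π M₂⊆π M₁∩M₂≡∅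
    with ⊆⇒dir∈span {M₁} {π} M₁⊆π | ⊆⇒dir∈span {M₂} {π} M₂⊆π
  ... | α₁ , β₁ , e₁ | α₂ , β₂ , e₂ with (α₁ * β₂ - α₂ * β₁) ≟ 0#
  ... | yes det≈0 = det≈0⇒Parallel {π} {M₁} {M₂} e₁ e₂ det≈0
  ... | no det≉0 with M₁⊆π (base M₁) (base∈ₗ M₁) | M₂⊆π (base M₂) (base∈ₗ M₂)
  ...   | _ , _ , f₁ | _ , _ , f₂ = ⊥-elim (M₁∩M₂≡∅ (det≉0⇒Intersect {π} {M₁} {M₂} e₁ e₂ f₁ f₂ det≉0))

module FiniteGeometry {c ℓ : Level} (F : CommutativeRing c ℓ) (isField : IsField F)
         {q : ℕ} (size : HasSize F q) where
  open CommutativeRing F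
  open IsField isField
  open AG3 F
  open Line
  open Plane
  open Finite {F = F} size
  open DiscreteFieldGeometry F isField _≟_

  Parallel? : ∀ L M → Dec (Parallel L M)
  Parallel? L M = ∃? resp (λ a → (_ ≟ _) ×-dec (_ ≟ _) ×-dec (_ ≟ _))
    where
    resp : ∀ {a b} → a ≈ b → dir L ≈ₚ (a · dir M) → dir L ≈ₚ (b · dir M)
    resp a≈b (h₁ , h₂ , h₃) = trans h₁ (*-congʳ a≈b) , trans h₂ (*-congʳ a≈b) , trans h₃ (*-congʳ a≈b)

  i₀ i₁ : Fin q
  i₀ = index 0#
  i₁ = index 1#

  i₀≢i₁ : i₀ ≢ i₁
  i₀≢i₁ = index-≉ 0≉1

  module CompleteBipartite (A B : Fin q → Line)
    (A-disjoint : ∀ j k → j ≢ k → ¬ Intersect (A j) (A k))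
    (B-disjoint : ∀ j k → j ≢ k → ¬ Intersect (B j) (B k))
    (A∩B : ∀ j k → Intersect (A j) (B k)) where

    module SpannedBy {j k : Fin q} (j≢k : j ≢ k) (Aj∥Ak : Parallel (A j) (A k)) where

      Aj∩Ak≡∅ : ¬ Intersect (A j) (A k)
      Aj∩Ak≡∅ = A-disjoint j k j≢k

      π : Plane
      π = spanPlane (A j) (A k) Aj∩Ak≡∅

      B⊆π : ∀ b → B b ⊆ π
      B⊆π b with A∩B j b | A∩B k b
      ... | P , P∈Aj , P∈Bb | P′ , P′∈Ak , P′∈Bb =
        two-points⇒⊆ {B b} {π} P∈Bb P′∈Bb
          (⊆spanPlaneˡ (A j) (A k) Aj∩Ak≡∅ P P∈Aj)
          (⊆spanPlaneʳ (A j) (A k) Aj∩Ak≡∅ (Parallel-sym {A j} {A k} Aj∥Ak) P′ P′∈Ak)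
          (λ P≈P′ → Aj∩Ak≡∅ (P , P∈Aj , ∈ₗ-resp-≈ₚ {L = A k} P≈P′ P′∈Ak))

      A⊆π : ∀ l → A l ⊆ π
      A⊆π l with A∩B l i₀ | A∩B l i₁
      ... | Q , Q∈Al , Q∈B₀ | Q′ , Q′∈Al , Q′∈B₁ =
        two-points⇒⊆ {A l} {π} Q∈Al Q′∈Al (B⊆π i₀ Q Q∈B₀) (B⊆π i₁ Q′ Q′∈B₁)
          (λ Q≈Q′ → B-disjoint i₀ i₁ i₀≢i₁ (Q , Q∈B₀ , ∈ₗ-resp-≈ₚ {L = B i₁} Q≈Q′ Q′∈B₁))

      A-parallel : ∀ l l′ → Parallel (A l) (A l′)
      A-parallel l l′ with l Fin.≟ l′
      ... | yes ≡.refl = Parallel-refl (A l)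
      ... | no l≢l′    = coplanar-disjoint⇒Parallel {π} {A l} {A l′} (A⊆π l) (A⊆π l′) (A-disjoint l l′ l≢l′)

      -- the lines of π parallel to u π = dir (A j) are the level sets of the v-coordinate
      v-coordinate : Fin q → Carrier
      v-coordinate l = A⊆π l (base (A l)) (base∈ₗ (A l)) .proj₂ .proj₁

      ∈A-if-same-v : ∀ l {X α′ c′} → X ≈ₚ (pbase π ⊕ ((α′ · u π) ⊕ (c′ · v π))) → v-coordinate l ≈ c′ → X ∈ₗ A l
      ∈A-if-same-v l hX v≈c′ =
        same-v⇒∈ₗ {π} {A l} (A⊆π l (base (A l)) (base∈ₗ (A l)) .proj₂ .proj₂) hX v≈c′ (A-parallel j l .proj₂)

      v-coordinate-injective : ∀ {l l′} → v-coordinate l ≈ v-coordinate l′ → l ≡ l′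
      v-coordinate-injective {l} {l′} v≈v′ with l Fin.≟ l′
      ... | yes l≡l′ = l≡l′
      ... | no l≢l′  = ⊥-elim (A-disjoint l l′ l≢l′ (base (A l′) ,
                         ∈A-if-same-v l (A⊆π l′ (base (A l′)) (base∈ₗ (A l′)) .proj₂ .proj₂) v≈v′ ,
                         base∈ₗ (A l′)))

      A-complete : ∀ m → m ⊆ π → (∀ l → Parallel m (A l)) → ∃ λ l → SameLine m (A l)
      A-complete m m⊆π m∥A =
        let _ , c , hm = m⊆π (base m) (base∈ₗ m)
            l , v≈c    = injective⇒covers v-coordinate v-coordinate-injective c
        in l , parallel-through⇒SameLine {m} {A l} (m∥A l) (∈A-if-same-v l hm v≈c)

      parallelClass : ∃ λ (π : Plane) → ParallelClassOf π A
      parallelClass = π , A⊆π , A-parallel , A-complete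

    parallelClass⊎skew : (∃ λ (π : Plane) → ParallelClassOf π A) ⊎ (∀ j k → j ≢ k → Skew (A j) (A k))
    parallelClass⊎skew with Parallel? (A i₀) (A i₁)
    ... | yes A₀∥A₁ = inj₁ (SpannedBy.parallelClass i₀≢i₁ A₀∥A₁)
    ... | no  A₀∦A₁ = inj₂ λ j k j≢k →
            A-disjoint j k j≢k , λ Aj∥Ak → A₀∦A₁ (SpannedBy.A-parallel j≢k Aj∥Ak i₀ i₁)

other : Fin 2 → Fin 2
other Fin.zero    = Fin.suc Fin.zero
other (Fin.suc _) = Fin.zero

other≢ : ∀ i → i ≢ other i
other≢ Fin.zero ()
other≢ (Fin.suc Fin.zero) ()

lemma3p1 : {c ℓ : Level} (F : CommutativeRing c ℓ) → IsField F →
    (q : ℕ) → HasSize F q →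
    let open AG3 F in
    (L : Fin 2 → Fin q → Line) →
    -- the 2q vertices of U are distinct lines
    (∀ i j i′ j′ → ¬ (i ≡ i′ × j ≡ j′) → ¬ SameLine (L i j) (L i′ j′)) →
    -- lines in the same part are pairwise non-intersecting
    (∀ i j k → ¬ j ≡ k → ¬ Intersect (L i j) (L i k)) →
    -- lines in different parts intersect
    (∀ i i′ j k → ¬ i ≡ i′ → Intersect (L i j) (L i′ k)) →
    ∀ (i : Fin 2) →
      (∃ λ (π : Plane) → ParallelClassOf π (L i))
      ⊎ (∀ j k → ¬ j ≡ k → Skew (L i j) (L i k))
lemma3p1 F isField q size L _ same-disjoint cross-meet i =
  CompleteBipartite.parallelClass⊎skew (L i) (L (other i)) (same-disjoint i) (same-disjoint (other i))
    (λ j k → cross-meet i (other i) j k (other≢ i))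
  where open FiniteGeometry F isField size
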